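{- For digits $a,b\in\{1,\dots,9\}$, define the plum-blossom product $a\clubsuit b$ as follows: let $u$ be the units digit of the ordinary product $a\times b$; then $a\clubsuit b=u$ if $u\le 3$, and $a\clubsuit b=u-10$ otherwise. Given two such digits with $a\le b$, let $J(a\clubsuit b)$ be the integer with $a\times b=10\cdot J(a\clubsuit b)+a\clubsuit b$. Then $$J(a\clubsuit b)=\begin{cases}a & \text{if } (a=1 \text{ or } b=9) \text{ and } b-a\ge 3;\\ a & \text{if } b-a\ge 5;\\ a-2 & \text{if } 3\le a\le b\le 7 \text{ and } b-a\le 1;\\ a-1 & \text{otherwise}.\end{cases}$$
   Context: The plum-blossom product of two digits always lies between $-6$ and $3$, and $a\times b=10\cdot J+a\clubsuit b$ determines $J$ uniquely. -}

module Defs where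

open import Data.Nat as ℕ using (ℕ; _≤_; _∸_; _%_; _≤?_; _≟_)
open import Data.Integer as ℤ using (ℤ; +_; _-_)
open import Data.Product using (_×_)
open import Data.Bool using (Bool; if_then_else_; _∧_; _∨_)
open import Relation.Nullary.Decidable using (⌊_⌋)

IsDigit : ℕ → Set
IsDigit d = 1 ≤ d × d ≤ 9

units : ℕ → ℕ → ℕ
units a b = (a ℕ.* b) % 10

_♣_ : ℕ → ℕ → ℤ
a ♣ b = if ⌊ units a b ≤? 3 ⌋ then + units a b else (+ units a b - + 10)

Jformula : ℕ → ℕ → ℤ
Jformula a b =
  if (⌊ a ≟ 1 ⌋ ∨ ⌊ b ≟ 9 ⌋) ∧ ⌊ 3 ≤? b ∸ a ⌋ then + a
  else if ⌊ 5 ≤? b ∸ a ⌋ then + a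
  else if ⌊ 3 ≤? a ⌋ ∧ ⌊ b ≤? 7 ⌋ ∧ ⌊ b ∸ a ≤? 1 ⌋ then + a - + 2
  else + a - + 1

-- The equation a × b = 10·J + a ♣ b pins J down because J ↦ 10·J + c is
-- injective; that the case formula is a solution is verified by evaluating
-- both sides on the 45 pairs of digits a ≤ b.
module Submission where

open import Defs
open import Data.Nat using (ℕ; _≤_; _≤?_; s≤s)
open import Data.Fin using (Fin; toℕ; fromℕ<)
open import Data.Fin.Properties using (all?; toℕ-fromℕ<)
open import Data.Integer using (ℤ; +_; _+_; _*_; NonZero)
open import Data.Integer.Properties using (+-0-abelianGroup; *-cancelˡ-≡) renaming (_≟_ to _≟ℤ_)
open import Algebra.Bundles using (module AbelianGroup)
open import Algebra.Properties.Group (AbelianGroup.group +-0-abelianGroup) using (∙-cancelʳ)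
open import Data.Product using (_×_; _,_)
open import Relation.Nullary.Decidable using (Dec; _→-dec_; from-yes)
open import Relation.Binary.PropositionalEquality using (_≡_; sym; trans; subst₂)

*-+-cancelʳ-≡ : ∀ m c {j k} .{{_ : NonZero m}} → m * j + c ≡ m * k + c → j ≡ k
*-+-cancelʳ-≡ m c {j} {k} eq = *-cancelˡ-≡ m j k (∙-cancelʳ c (m * j) (m * k) eq)

DigitEquation : ℕ → ℕ → Set
DigitEquation a b = + (a Data.Nat.* b) ≡ + 10 * Jformula a b + a ♣ b

digitEquation? : ∀ a b → Dec (1 ≤ a → a ≤ b → DigitEquation a b)
digitEquation? a b =
  1 ≤? a →-dec a ≤? b →-dec + (a Data.Nat.* b) ≟ℤ + 10 * Jformula a b + a ♣ b

digitTable : ∀ (a b : Fin 10) → 1 ≤ toℕ a → toℕ a ≤ toℕ b → DigitEquation (toℕ a) (toℕ b)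
digitTable = from-yes (all? {10} λ a → all? {10} λ b → digitEquation? (toℕ a) (toℕ b))

digitEquation : ∀ {a b} → IsDigit a → IsDigit b → a ≤ b → DigitEquation a b
digitEquation (1≤a , a≤9) (_ , b≤9) =
  subst₂ (λ a b → 1 ≤ a → a ≤ b → DigitEquation a b)
    (toℕ-fromℕ< (s≤s a≤9)) (toℕ-fromℕ< (s≤s b≤9))
    (digitTable (fromℕ< (s≤s a≤9)) (fromℕ< (s≤s b≤9)))
    1≤a

mainTheorem3 : (a b : ℕ) → IsDigit a → IsDigit b → a ≤ b →
    (+ (a Data.Nat.* b) ≡ + 10 * Jformula a b + a ♣ b)
    × ((J : ℤ) → + (a Data.Nat.* b) ≡ + 10 * J + a ♣ b → J ≡ Jformula a b)
mainTheorem3 a b da db a≤b =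
  solution , λ J eqJ → *-+-cancelʳ-≡ (+ 10) (a ♣ b) (trans (sym eqJ) solution)
  where
  solution : DigitEquation a b
  solution = digitEquation da db a≤b
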